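{- Let $p>3$ be a prime. Then $$\sum_{k=1}^{[\frac{p+1}{3}]}\frac{(-8)^k}{12k-8}+\sum_{k=1}^{[\frac p3]}\frac{(-8)^k}{6k-2}\equiv\left(\frac{ -3}{p}\right)\big(2q_p(2)-q_p(3)\big)\pmod p.$$
   Context: $[x]$ denotes the integer part of $x$; $\left(\frac{ -3}{p}\right)$ is the Legendre symbol; $q_p(x)=\frac{x^{p-1}-1}{p}$ for $p\nmid x$. Congruences between rationals with denominators prime to $p$ are understood in the ring of $p$-integral rationals. -}

module Defs where

open import Data.Nat as ℕ using (ℕ; zero; suc)
open import Data.Integer as ℤ using (ℤ; +_; -[1+_])
open import Data.Integer.Divisibility.Signed as ℤDiv using (_∣?_)
open import Data.Nat.Divisibility as ℕDiv using ()
open import Data.Rational as ℚ using (ℚ; ↥_; ↧ₙ_)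
open import Data.List using (upTo)
open import Data.List.Relation.Unary.Any using (any?)
open import Data.Product using (_×_)
open import Relation.Nullary using (¬_; yes; no)

sumFrom1 : ℕ → (ℕ → ℚ) → ℚ
sumFrom1 zero    f = ℚ.0ℚ
sumFrom1 (suc n) f = sumFrom1 n f ℚ.+ f (suc n)

legendre : ℤ → ℕ → ℤ
legendre a p with (+ p) ∣? a
... | yes _ = + 0
... | no  _ with any? (λ x → (+ p) ∣? ((+ x) ℤ.* (+ x) ℤ.- a)) (upTo p)
...   | yes _ = + 1
...   | no  _ = -[1+ 0 ]

fermatQuotient : (p : ℕ) → .{{ℕ.NonZero p}} → ℤ → ℚ
fermatQuotient p x = ((x ℤ.^ (p ℕ.∸ 1)) ℤ.- + 1) ℚ./ p

-- Congruence mod p in the ring of p-integral rationals: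
-- a - b (in lowest terms) has numerator divisible by p and denominator prime to p.
_≡_[modℚ_] : ℚ → ℚ → ℕ → Set
a ≡ b [modℚ p ] = ((+ p) ℤDiv.∣ (↥ (a ℚ.- b))) × ¬ (p ℕDiv.∣ (↧ₙ (a ℚ.- b)))

-- For 0 < m < p we have C(p,m)/p ≡ (-1)^(m-1)/m (mod p), and the terms of the left-hand side
-- are χ(m)(-2)^m/m for m = 3k - 2 and m = 3k - 1, where χ = (·/3). So the left-hand side is
-- congruent to -V/p with V = Σ_{0<m<p} χ(m) 2^m C(p,m). The sums A_r(n) = Σ_m χ(m+r) 2^m C(n,m)
-- satisfy A_r(n+1) = A_r(n) + 2 A_{r+1}(n) and A₀ + A₁ + A₂ = 0, hence A₀(n+2) = -3 A₀(n), and
-- V = A₀(p) - χ(p) 2^p = 2t - χ(p) 2^p with t = (-3)^((p-1)/2). As p ∣ V and 2^p ≡ 2, this is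
-- Euler's criterion t ≡ χ(p); together with a square root of -3 for p ≡ 1 (mod 3), built from a
-- non-root of x^((p-1)/3) = 1, it gives (-3/p) = χ(p) =: L. Since 3^(p-1) = t² and L² = 1, the
-- difference of the two sides is L (t - L)²/p ≡ 0.

module Submission where

open import Defs
open import Data.Nat as ℕ using (ℕ; zero; suc; _>_; _!)
import Data.Nat.Properties as ℕP
import Data.Nat.Divisibility as ℕ∣
import Data.Nat.Coprimality as Coprimality
open import Data.Nat.DivMod using (m≡m%n+[m/n]*n; m%n<n; +-distrib-/-∣ʳ; m<n⇒m/n≡0; m*n/n≡m; m/n*n≤m)
open import Data.Nat.Combinatorics using (_C_; nCn≡1; nC1≡n; k>n⇒nCk≡0; nCk+nC[k+1]≡[n+1]C[k+1])
open import Data.Nat.Primality using (Prime; ¬prime[1]; euclidsLemma; prime⇒nonTrivial; prime⇒nonZero; composite)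
open import Data.Nat.Tactic.RingSolver using () renaming (solve-∀ to ℕ-solve-∀)
open import Data.Integer as ℤ using (ℤ; +_; -[1+_]; -1ℤ; _+_; _*_; _-_; -_; _^_)
import Data.Integer.Properties as ℤP
open import Data.Integer.DivMod using (_%ℕ_; _/ℕ_; n%ℕd<d; a≡a%ℕn+[a/ℕn]*n)
open import Data.Integer.Divisibility.Signed as ℤ∣ using (_∣_; divides; _∣?_)
open import Data.Integer.Tactic.RingSolver using (solve-∀)
open import Data.Rational as ℚ using (ℚ; _/_; ↥_; ↧_; ↧ₙ_)
import Data.Rational.Properties as ℚP
open import Data.Rational.Solver using (module +-*-Solver)
open import Data.Rational.Unnormalised using (mkℚᵘ; *≡*)
import Data.Rational.Unnormalised.Properties as ℚᵘP
open import Data.Fin using (Fin; toℕ; fromℕ<)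
open import Data.Fin.Properties using (¬∀⟶∃¬; toℕ-fromℕ<; toℕ<n)
open import Data.List using (upTo)
open import Data.List.Relation.Unary.Any using (any?; satisfied)
open import Data.List.Membership.Propositional using (lose)
open import Data.List.Membership.Propositional.Properties using (∈-upTo⁺)
open import Data.Product using (∃; ∃₂; _×_; _,_; proj₁; proj₂)
open import Data.Sum using (_⊎_; inj₁; inj₂; [_,_]′)
open import Data.Empty using (⊥-elim)
open import Function using (id; flip)
open import Relation.Nullary using (¬_; yes; no; contradiction)
open import Relation.Binary.PropositionalEquality

-- Finite sums and binomial coefficients

∑ : ℕ → (ℕ → ℤ) → ℤ
∑ zero    f = + 0
∑ (suc n) f = f 0 + ∑ n (λ k → f (suc k))

∑-last : ∀ n f → ∑ (suc n) f ≡ ∑ n f + f n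
∑-last zero    f = ℤP.+-comm (f 0) (+ 0)
∑-last (suc n) f = begin
  f 0 + ∑ (suc n) (λ k → f (suc k))      ≡⟨ cong (_+_ (f 0)) (∑-last n (λ k → f (suc k))) ⟩
  f 0 + (∑ n (λ k → f (suc k)) + f (suc n)) ≡⟨ ℤP.+-assoc (f 0) _ _ ⟨
  f 0 + ∑ n (λ k → f (suc k)) + f (suc n)   ∎
  where open ≡-Reasoning

∑-cong : ∀ n {f g} → (∀ k → k ℕ.< n → f k ≡ g k) → ∑ n f ≡ ∑ n g
∑-cong zero    eq = refl
∑-cong (suc n) eq = cong₂ _+_ (eq 0 ℕ.z<s) (∑-cong n (λ k k<n → eq (suc k) (ℕ.s<s k<n)))

∑-distrib-+ : ∀ n f g → ∑ n (λ k → f k + g k) ≡ ∑ n f + ∑ n g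
∑-distrib-+ zero    f g = refl
∑-distrib-+ (suc n) f g = trans
  (cong (_+_ (f 0 + g 0)) (∑-distrib-+ n (λ k → f (suc k)) (λ k → g (suc k))))
  (interchange (f 0) (g 0) _ _)
  where
  interchange : ∀ a b c d → a + b + (c + d) ≡ a + c + (b + d)
  interchange = solve-∀

∑-distribˡ-* : ∀ n c f → ∑ n (λ k → c * f k) ≡ c * ∑ n f
∑-distribˡ-* zero    c f = sym (ℤP.*-zeroʳ c)
∑-distribˡ-* (suc n) c f = trans
  (cong (_+_ (c * f 0)) (∑-distribˡ-* n c (λ k → f (suc k))))
  (sym (ℤP.*-distribˡ-+ c (f 0) _))

∑-neg : ∀ n f → ∑ n (λ k → - f k) ≡ - ∑ n f
∑-neg zero    f = refl
∑-neg (suc n) f = trans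
  (cong (_+_ (- f 0)) (∑-neg n (λ k → f (suc k))))
  (sym (ℤP.neg-distrib-+ (f 0) _))

∑-zero : ∀ n {f} → (∀ k → k ℕ.< n → f k ≡ + 0) → ∑ n f ≡ + 0
∑-zero zero    eq = refl
∑-zero (suc n) eq = cong₂ _+_ (eq 0 ℕ.z<s) (∑-zero n (λ k k<n → eq (suc k) (ℕ.s<s k<n)))

∑-swap : ∀ n m (f : ℕ → ℕ → ℤ) → ∑ n (λ i → ∑ m (f i)) ≡ ∑ m (λ j → ∑ n (λ i → f i j))
∑-swap zero    m f = sym (∑-zero m (λ _ _ → refl))
∑-swap (suc n) m f = trans
  (cong (_+_ (∑ m (f 0))) (∑-swap n m (λ i → f (suc i))))
  (sym (∑-distrib-+ m (f 0) _))

∣∑ : ∀ n {d f} → (∀ k → k ℕ.< n → d ∣ f k) → d ∣ ∑ n f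
∣∑ zero    _  = divides (+ 0) refl
∣∑ (suc n) d∣ = ℤ∣.∣m∣n⇒∣m+n (d∣ 0 ℕ.z<s) (∣∑ n (λ k k<n → d∣ (suc k) (ℕ.s<s k<n)))

[1+k]*[1+n]C[1+k]≡[1+n]*nCk : ∀ n k → suc k ℕ.* (suc n C suc k) ≡ suc n ℕ.* (n C k)
[1+k]*[1+n]C[1+k]≡[1+n]*nCk zero    zero     = refl
[1+k]*[1+n]C[1+k]≡[1+n]*nCk zero    (suc k)  =
  trans (cong (suc (suc k) ℕ.*_) (k>n⇒nCk≡0 {1} {suc (suc k)} (ℕ.s<s ℕ.z<s))) (ℕP.*-zeroʳ (suc (suc k)))
[1+k]*[1+n]C[1+k]≡[1+n]*nCk (suc n) zero    = trans (ℕP.*-identityˡ _) (trans (nC1≡n (suc (suc n))) (sym (ℕP.*-identityʳ _)))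
[1+k]*[1+n]C[1+k]≡[1+n]*nCk (suc n) (suc k) = begin
  suc (suc k) ℕ.* (suc (suc n) C suc (suc k))
    ≡⟨ cong (suc (suc k) ℕ.*_) (nCk+nC[k+1]≡[n+1]C[k+1] (suc n) (suc k)) ⟨
  suc (suc k) ℕ.* (a ℕ.+ b)
    ≡⟨ regroup (suc k) a b ⟩
  suc k ℕ.* a ℕ.+ a ℕ.+ suc (suc k) ℕ.* b
    ≡⟨ cong₂ (λ x y → x ℕ.+ a ℕ.+ y) ([1+k]*[1+n]C[1+k]≡[1+n]*nCk n k) ([1+k]*[1+n]C[1+k]≡[1+n]*nCk n (suc k)) ⟩
  suc n ℕ.* (n C k) ℕ.+ a ℕ.+ suc n ℕ.* (n C suc k)
    ≡⟨ regroup′ n a (n C k) (n C suc k) ⟩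
  suc n ℕ.* (n C k ℕ.+ n C suc k) ℕ.+ a
    ≡⟨ cong (λ x → suc n ℕ.* x ℕ.+ a) (nCk+nC[k+1]≡[n+1]C[k+1] n k) ⟩
  suc n ℕ.* a ℕ.+ a
    ≡⟨ ℕP.+-comm (suc n ℕ.* a) a ⟩
  suc (suc n) ℕ.* a ∎
  where
  open ≡-Reasoning
  a = suc n C suc k
  b = suc n C suc (suc k)
  regroup : ∀ k a b → suc k ℕ.* (a ℕ.+ b) ≡ k ℕ.* a ℕ.+ a ℕ.+ suc k ℕ.* b
  regroup = ℕ-solve-∀
  regroup′ : ∀ n a x y → suc n ℕ.* x ℕ.+ a ℕ.+ suc n ℕ.* y ≡ suc n ℕ.* (x ℕ.+ y) ℕ.+ a
  regroup′ = ℕ-solve-∀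

[1+n]Cn≡1+n : ∀ n → suc n C n ≡ suc n
[1+n]Cn≡1+n zero    = refl
[1+n]Cn≡1+n (suc n) = begin
  suc (suc n) C suc n               ≡⟨ nCk+nC[k+1]≡[n+1]C[k+1] (suc n) n ⟨
  suc n C n ℕ.+ suc n C suc n       ≡⟨ cong₂ ℕ._+_ ([1+n]Cn≡1+n n) (nCn≡1 (suc n)) ⟩
  suc n ℕ.+ 1                       ≡⟨ ℕP.+-comm (suc n) 1 ⟩
  suc (suc n) ∎
  where open ≡-Reasoning

binomialTransform : (ℕ → ℤ) → ℕ → ℤ
binomialTransform w n = ∑ (suc n) (λ m → w m * + (n C m))

binomialTransform-suc : ∀ w n →
  binomialTransform w (suc n) ≡ binomialTransform w n + binomialTransform (λ m → w (suc m)) n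
binomialTransform-suc w n = begin
  w 0 * + 1 + ∑ (suc n) (λ m → w (suc m) * + (suc n C suc m))
    ≡⟨ cong (_+_ (w 0 * + 1)) (∑-cong (suc n) (λ m _ → pascal m)) ⟩
  w 0 * + 1 + ∑ (suc n) (λ m → w (suc m) * + (n C m) + w (suc m) * + (n C suc m))
    ≡⟨ cong (_+_ (w 0 * + 1)) (∑-distrib-+ (suc n) (λ m → w (suc m) * + (n C m)) (λ m → w (suc m) * + (n C suc m))) ⟩
  w 0 * + 1 + (T + ∑ (suc n) (λ m → w (suc m) * + (n C suc m)))
    ≡⟨ cong (λ x → w 0 * + 1 + (T + x)) (∑-last n (λ m → w (suc m) * + (n C suc m))) ⟩
  w 0 * + 1 + (T + (S + w (suc n) * + (n C suc n)))
    ≡⟨ cong (λ x → w 0 * + 1 + (T + (S + w (suc n) * + x))) (k>n⇒nCk≡0 (ℕP.n<1+n n)) ⟩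
  w 0 * + 1 + (T + (S + w (suc n) * + 0))
    ≡⟨ regroup (w 0) T S (w (suc n)) ⟩
  w 0 * + 1 + S + T ∎
  where
  open ≡-Reasoning
  T = binomialTransform (λ m → w (suc m)) n
  S = ∑ n (λ m → w (suc m) * + (n C suc m))
  pascal : ∀ m → w (suc m) * + (suc n C suc m) ≡ w (suc m) * + (n C m) + w (suc m) * + (n C suc m)
  pascal m = trans
    (cong (λ x → w (suc m) * + x) (sym (nCk+nC[k+1]≡[n+1]C[k+1] n m)))
    (ℤP.*-distribˡ-+ (w (suc m)) (+ (n C m)) (+ (n C suc m)))
  regroup : ∀ a t s b → a * + 1 + (t + (s + b * + 0)) ≡ a * + 1 + s + t
  regroup = solve-∀

binomialTheorem : ∀ x n → (x + + 1) ^ n ≡ binomialTransform (x ^_) n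
binomialTheorem x zero    = refl
binomialTheorem x (suc n) = begin
  (x + + 1) * (x + + 1) ^ n       ≡⟨ cong ((x + + 1) *_) (binomialTheorem x n) ⟩
  (x + + 1) * B                   ≡⟨ distrib x B ⟩
  B + x * B                       ≡⟨ cong (_+_ B) (sym (∑-distribˡ-* (suc n) x (λ m → x ^ m * + (n C m)))) ⟩
  B + ∑ (suc n) (λ m → x * (x ^ m * + (n C m)))
    ≡⟨ cong (_+_ B) (∑-cong (suc n) (λ m _ → sym (ℤP.*-assoc x (x ^ m) (+ (n C m))))) ⟩
  B + binomialTransform (λ m → x ^ suc m) n
    ≡⟨ binomialTransform-suc (x ^_) n ⟨
  binomialTransform (x ^_) (suc n) ∎
  where
  open ≡-Reasoning
  B = binomialTransform (x ^_) n
  distrib : ∀ x b → (x + + 1) * b ≡ b + x * b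
  distrib = solve-∀

-- Arithmetic modulo a prime

pos-suc : ∀ a → + suc a ≡ + a + + 1
pos-suc a = trans (ℤP.pos-+ 1 a) (ℤP.+-comm (+ 1) (+ a))

^-distribʳ-* : ∀ x y n → (x * y) ^ n ≡ x ^ n * y ^ n
^-distribʳ-* x y zero    = refl
^-distribʳ-* x y (suc n) = trans (cong ((x * y) *_) (^-distribʳ-* x y n)) (interchange x y (x ^ n) (y ^ n))
  where
  interchange : ∀ a b c d → a * b * (c * d) ≡ a * c * (b * d)
  interchange = solve-∀

[-1]^n*[-1]^n≡1 : ∀ n → -1ℤ ^ n * -1ℤ ^ n ≡ + 1
[-1]^n*[-1]^n≡1 n = trans (sym (^-distribʳ-* -1ℤ -1ℤ n)) (ℤP.^-zeroˡ n)

[a*a]^h≡a^[h+h] : ∀ a h → (a * a) ^ h ≡ a ^ (h ℕ.+ h)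
[a*a]^h≡a^[h+h] a h = trans (^-distribʳ-* a a h) (sym (ℤP.^-distribˡ-+-* a h h))

∣-^ : ∀ {d} a b n → d ∣ a - b → d ∣ a ^ n - b ^ n
∣-^ a b zero    _    = divides (+ 0) refl
∣-^ a b (suc n) d∣a-b = subst (_ ∣_) (telescope a b (a ^ n) (b ^ n))
  (ℤ∣.∣m∣n⇒∣m+n (ℤ∣.∣n⇒∣m*n a (∣-^ a b n d∣a-b)) (ℤ∣.∣n⇒∣m*n (b ^ n) d∣a-b))
  where
  telescope : ∀ a b x y → a * (x - y) + y * (a - b) ≡ a * x - b * y
  telescope = solve-∀

residue3 : ∀ N → ∃ λ j → N ≡ 3 ℕ.* j ⊎ N ≡ 1 ℕ.+ 3 ℕ.* j ⊎ N ≡ 2 ℕ.+ 3 ℕ.* j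
residue3 N with N ℕ.% 3 | m≡m%n+[m/n]*n N 3 | m%n<n N 3
... | 0 | N≡ | _ = N ℕ./ 3 , inj₁ (trans N≡ (ℕP.*-comm (N ℕ./ 3) 3))
... | 1 | N≡ | _ = N ℕ./ 3 , inj₂ (inj₁ (trans N≡ (cong (1 ℕ.+_) (ℕP.*-comm (N ℕ./ 3) 3))))
... | 2 | N≡ | _ = N ℕ./ 3 , inj₂ (inj₂ (trans N≡ (cong (2 ℕ.+_) (ℕP.*-comm (N ℕ./ 3) 3))))
... | suc (suc (suc _)) | _ | ℕ.s≤s (ℕ.s≤s (ℕ.s≤s ()))

[r+3j]/3≡j : ∀ {M} r j → r ℕ.< 3 → M ≡ r ℕ.+ 3 ℕ.* j → M ℕ./ 3 ≡ j
[r+3j]/3≡j r j r<3 refl = begin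
  (r ℕ.+ 3 ℕ.* j) ℕ./ 3       ≡⟨ +-distrib-/-∣ʳ r (ℕ∣.divides j (ℕP.*-comm 3 j)) ⟩
  r ℕ./ 3 ℕ.+ (3 ℕ.* j) ℕ./ 3
    ≡⟨ cong₂ ℕ._+_ (m<n⇒m/n≡0 r<3) (trans (cong (ℕ._/ 3) (ℕP.*-comm 3 j)) (m*n/n≡m j 3)) ⟩
  j ∎
  where open ≡-Reasoning

j<M/3⇒3+3j≤M : ∀ {j M} → j ℕ.< M ℕ./ 3 → 3 ℕ.+ 3 ℕ.* j ℕ.≤ M
j<M/3⇒3+3j≤M {j} {M} j<M/3 = subst (ℕ._≤ M) (unfold j) (ℕP.≤-trans (ℕP.*-monoˡ-≤ 3 j<M/3) (m/n*n≤m M 3))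
  where
  unfold : ∀ j → suc j ℕ.* 3 ≡ 3 ℕ.+ 3 ℕ.* j
  unfold = ℕ-solve-∀

∤-small : ∀ {p k} → .{{ℕ.NonZero k}} → k ℕ.< p → ¬ (+ p ∣ + k)
∤-small k<p p∣k = ℕ∣.>⇒∤ k<p (ℤ∣.∣⇒∣ᵤ p∣k)

module _ {p : ℕ} (p-prime : Prime p) where

  euclidsLemmaℤ : ∀ a b → + p ∣ a * b → + p ∣ a ⊎ + p ∣ b
  euclidsLemmaℤ a b p∣ab
    with euclidsLemma ℤ.∣ a ∣ ℤ.∣ b ∣ p-prime (subst (p ℕ∣.∣_) (ℤP.abs-* a b) (ℤ∣.∣⇒∣ᵤ p∣ab))
  ... | inj₁ p∣a = inj₁ (ℤ∣.∣ᵤ⇒∣ p∣a)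
  ... | inj₂ p∣b = inj₂ (ℤ∣.∣ᵤ⇒∣ p∣b)

  ∣-*-cancelˡ : ∀ {a b} → ¬ (+ p ∣ a) → + p ∣ a * b → + p ∣ b
  ∣-*-cancelˡ {a} {b} p∤a p∣ab = [ flip contradiction p∤a , id ]′ (euclidsLemmaℤ a b p∣ab)

  ∣-*-cancelʳ : ∀ {a b} → ¬ (+ p ∣ b) → + p ∣ a * b → + p ∣ a
  ∣-*-cancelʳ {a} {b} p∤b p∣ab = [ id , flip contradiction p∤b ]′ (euclidsLemmaℤ a b p∣ab)

  ∤-* : ∀ {a b} → ¬ (+ p ∣ a) → ¬ (+ p ∣ b) → ¬ (+ p ∣ a * b)
  ∤-* {a} {b} p∤a p∤b p∣ab = [ p∤a , p∤b ]′ (euclidsLemmaℤ a b p∣ab)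

p∣pC[1+k] : ∀ {p} → Prime p → ∀ k → suc k ℕ.< p → + p ∣ + (p C suc k)
p∣pC[1+k] {suc P} p-prime k k<p with euclidsLemma (suc P C suc k) (suc k) p-prime (ℕ∣.divides (P C k) absorption)
  where
  absorption : (suc P C suc k) ℕ.* suc k ≡ (P C k) ℕ.* suc P
  absorption = trans (ℕP.*-comm (suc P C suc k) (suc k))
    (trans ([1+k]*[1+n]C[1+k]≡[1+n]*nCk P k) (ℕP.*-comm (suc P) (P C k)))
... | inj₁ p∣C   = ℤ∣.∣ᵤ⇒∣ p∣C
... | inj₂ p∣1+k = ⊥-elim (∤-small k<p (ℤ∣.∣ᵤ⇒∣ p∣1+k))

[p-1]Ck≡[-1]^k : ∀ {P} → Prime (suc P) → ∀ k → k ℕ.≤ P → + suc P ∣ + (P C k) - -1ℤ ^ k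
[p-1]Ck≡[-1]^k p-prime zero    _   = divides (+ 0) refl
[p-1]Ck≡[-1]^k {P} p-prime (suc k) k<P = subst (_ ∣_) eq
  (ℤ∣.∣m∣n⇒∣m-n (p∣pC[1+k] p-prime k (ℕ.s<s k<P)) ([p-1]Ck≡[-1]^k p-prime k (ℕP.<⇒≤ k<P)))
  where
  eq : + (suc P C suc k) - (+ (P C k) - -1ℤ ^ k) ≡ + (P C suc k) - -1ℤ ^ suc k
  eq = trans
    (cong (λ c → + c - (+ (P C k) - -1ℤ ^ k)) (sym (nCk+nC[k+1]≡[n+1]C[k+1] P k)))
    (pascal-step (+ (P C k)) (+ (P C suc k)) (-1ℤ ^ k))
    where
    pascal-step : ∀ a b s → (a + b) - (a - s) ≡ b - -1ℤ * s
    pascal-step = solve-∀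

fermat : ∀ {p} → Prime p → ∀ x → + p ∣ (+ x) ^ p - + x
fermat {suc P} p-prime zero    = divides (+ 0) (ℤP.*-zeroˡ ((+ 0) ^ P))
fermat {suc P} p-prime (suc x) = subst (_ ∣_) (sym eq)
  (ℤ∣.∣m∣n⇒∣m+n (fermat p-prime x)
    (∣∑ P (λ m m<P → ℤ∣.∣n⇒∣m*n ((+ x) ^ suc m) (p∣pC[1+k] p-prime m (ℕ.s<s m<P)))))
  where
  p = suc P
  M = ∑ P (λ m → (+ x) ^ suc m * + (p C suc m))
  eq : (+ suc x) ^ p - + suc x ≡ ((+ x) ^ p - + x) + M
  eq = begin
    (+ suc x) ^ p - + suc x
      ≡⟨ cong (λ y → y ^ p - y) (pos-suc x) ⟩
    (+ x + + 1) ^ p - (+ x + + 1)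
      ≡⟨ cong (_- (+ x + + 1)) (binomialTheorem (+ x) p) ⟩
    + 1 * + 1 + ∑ p (λ m → (+ x) ^ suc m * + (p C suc m)) - (+ x + + 1)
      ≡⟨ cong (λ s → + 1 * + 1 + s - (+ x + + 1)) (∑-last P (λ m → (+ x) ^ suc m * + (p C suc m))) ⟩
    + 1 * + 1 + (M + (+ x) ^ p * + (p C p)) - (+ x + + 1)
      ≡⟨ cong (λ c → + 1 * + 1 + (M + (+ x) ^ p * + c) - (+ x + + 1)) (nCn≡1 p) ⟩
    + 1 * + 1 + (M + (+ x) ^ p * + 1) - (+ x + + 1)
      ≡⟨ regroup M ((+ x) ^ p) (+ x) ⟩
    ((+ x) ^ p - + x) + M ∎
    where
    open ≡-Reasoning
    regroup : ∀ m c y → + 1 * + 1 + (m + c * + 1) - (y + + 1) ≡ (c - y) + m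
    regroup = solve-∀

fermat′ : ∀ {p} → Prime p → ∀ {x} → ¬ (+ p ∣ + x) → + p ∣ (+ x) ^ (p ℕ.∸ 1) - + 1
fermat′ {suc P} p-prime {x} p∤x = ∣-*-cancelˡ p-prime p∤x (subst (_ ∣_) (factor (+ x) ((+ x) ^ P)) (fermat p-prime x))
  where
  factor : ∀ a b → a * b - a ≡ a * (b - + 1)
  factor = solve-∀

p∤n! : ∀ {p} → Prime p → ∀ {n} → n ℕ.< p → ¬ (p ℕ∣.∣ n !)
p∤n! {p} p-prime {zero}  _   = ℕ∣.>⇒∤ (ℕ.nonTrivial⇒n>1 p {{prime⇒nonTrivial p-prime}})
p∤n! {p} p-prime {suc n} n<p p∣n! with euclidsLemma (suc n) (n !) p-prime p∣n!
... | inj₁ p∣1+n = ℕ∣.>⇒∤ n<p p∣1+n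
... | inj₂ p∣n!′ = p∤n! p-prime (ℕP.<-trans (ℕP.n<1+n n) n<p) p∣n!′

prime-mod3 : ∀ {p} → Prime p → 3 ℕ.< p → ∃ λ j → p ≡ 1 ℕ.+ 3 ℕ.* j ⊎ p ≡ 2 ℕ.+ 3 ℕ.* j
prime-mod3 {p} p-prime 3<p with residue3 p
... | j , inj₁ p≡3j = ⊥-elim (Prime.notComposite p-prime (composite 3<p (ℕ∣.divides j (trans p≡3j (ℕP.*-comm 3 j)))))
... | j , inj₂ p≢0   = j , p≢0

prime-odd : ∀ {p} → Prime p → 2 ℕ.< p → ∃ λ h → p ≡ suc (h ℕ.+ h)
prime-odd {p} p-prime 2<p with p ℕ.% 2 | m≡m%n+[m/n]*n p 2 | m%n<n p 2
... | 0 | p≡ | _ = ⊥-elim (Prime.notComposite p-prime (composite 2<p (ℕ∣.divides (p ℕ./ 2) p≡)))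
... | 1 | p≡ | _ = p ℕ./ 2 , trans p≡ (cong suc (double (p ℕ./ 2)))
  where
  double : ∀ h → h ℕ.* 2 ≡ h ℕ.+ h
  double = ℕ-solve-∀
... | suc (suc _) | _ | ℕ.s≤s (ℕ.s≤s ())

odd-prime>2 : ∀ {h} → Prime (suc (h ℕ.+ h)) → 2 ℕ.< suc (h ℕ.+ h)
odd-prime>2 {zero}   p-prime = ⊥-elim (¬prime[1] p-prime)
odd-prime>2 {suc h}  _       = ℕ.s<s (ℕ.s<s (ℕP.≤-trans ℕ.z<s (ℕP.m≤n+m (suc h) h)))

-- Finite differences

-- ∇ n f = Σₖ (-1)ᵏ C(n,k) f(k), which is (-1)ⁿ Δⁿf(0) for the forward difference Δ.
∇ : ℕ → (ℕ → ℤ) → ℤ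
∇ n f = binomialTransform (λ k → -1ℤ ^ k * f k) n

∇-cong : ∀ n {f g} → (∀ k → f k ≡ g k) → ∇ n f ≡ ∇ n g
∇-cong n f≗g = ∑-cong (suc n) (λ k _ → cong (λ y → -1ℤ ^ k * y * + (n C k)) (f≗g k))

∇-suc : ∀ n f → ∇ (suc n) f ≡ ∇ n f - ∇ n (λ k → f (suc k))
∇-suc n f = trans (binomialTransform-suc (λ k → -1ℤ ^ k * f k) n) (cong (_+_ (∇ n f)) (trans
  (∑-cong (suc n) (λ k _ → sign (-1ℤ ^ k) (f (suc k)) (+ (n C k))))
  (∑-neg (suc n) (λ k → -1ℤ ^ k * f (suc k) * + (n C k)))))
  where
  sign : ∀ s y c → -1ℤ * s * y * c ≡ - (s * y * c)
  sign = solve-∀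

∇-*ˡ : ∀ n a f → ∇ n (λ k → a * f k) ≡ a * ∇ n f
∇-*ˡ n a f = trans
  (∑-cong (suc n) (λ k _ → shuffle (-1ℤ ^ k) a (f k) (+ (n C k))))
  (∑-distribˡ-* (suc n) a (λ k → -1ℤ ^ k * f k * + (n C k)))
  where
  shuffle : ∀ s a y c → s * (a * y) * c ≡ a * (s * y * c)
  shuffle = solve-∀

∇-sub : ∀ n f g → ∇ n (λ k → f k - g k) ≡ ∇ n f - ∇ n g
∇-sub n f g = begin
  ∇ n (λ k → f k - g k)
    ≡⟨ ∑-cong (suc n) (λ k _ → expand (-1ℤ ^ k) (f k) (g k) (+ (n C k))) ⟩
  ∑ (suc n) (λ k → -1ℤ ^ k * f k * + (n C k) + - (-1ℤ ^ k * g k * + (n C k)))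
    ≡⟨ ∑-distrib-+ (suc n) (λ k → -1ℤ ^ k * f k * + (n C k)) (λ k → - (-1ℤ ^ k * g k * + (n C k))) ⟩
  ∇ n f + ∑ (suc n) (λ k → - (-1ℤ ^ k * g k * + (n C k)))
    ≡⟨ cong (_+_ (∇ n f)) (∑-neg (suc n) (λ k → -1ℤ ^ k * g k * + (n C k))) ⟩
  ∇ n f - ∇ n g ∎
  where
  open ≡-Reasoning
  expand : ∀ s x y c → s * (x - y) * c ≡ s * x * c + - (s * y * c)
  expand = solve-∀

∇-∑ : ∀ n m (F : ℕ → ℕ → ℤ) → ∇ n (λ k → ∑ m (λ j → F j k)) ≡ ∑ m (λ j → ∇ n (F j))
∇-∑ n m F = trans
  (∑-cong (suc n) (λ k _ → pull-in k))
  (∑-swap (suc n) m (λ k j → -1ℤ ^ k * F j k * + (n C k)))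
  where
  pull-in : ∀ k → -1ℤ ^ k * ∑ m (λ j → F j k) * + (n C k) ≡ ∑ m (λ j → -1ℤ ^ k * F j k * + (n C k))
  pull-in k = begin
    -1ℤ ^ k * ∑ m (λ j → F j k) * + (n C k)
      ≡⟨ ℤP.*-comm (-1ℤ ^ k * ∑ m (λ j → F j k)) (+ (n C k)) ⟩
    + (n C k) * (-1ℤ ^ k * ∑ m (λ j → F j k))
      ≡⟨ cong (+ (n C k) *_) (∑-distribˡ-* m (-1ℤ ^ k) (λ j → F j k)) ⟨
    + (n C k) * ∑ m (λ j → -1ℤ ^ k * F j k)
      ≡⟨ ∑-distribˡ-* m (+ (n C k)) (λ j → -1ℤ ^ k * F j k) ⟨
    ∑ m (λ j → + (n C k) * (-1ℤ ^ k * F j k))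
      ≡⟨ ∑-cong m (λ j _ → ℤP.*-comm (+ (n C k)) (-1ℤ ^ k * F j k)) ⟩
    ∑ m (λ j → -1ℤ ^ k * F j k * + (n C k)) ∎
    where open ≡-Reasoning

∇-power-suc : ∀ n m a → ∇ (suc n) (λ k → (+ k + a) ^ m) ≡ - ∑ m (λ j → + (m C j) * ∇ n (λ k → (+ k + a) ^ j))
∇-power-suc n m a = begin
  ∇ (suc n) (P m)                 ≡⟨ ∇-suc n (P m) ⟩
  ∇ n (P m) - ∇ n (λ k → P m (suc k)) ≡⟨ cong (_-_ (∇ n (P m))) shifted ⟩
  ∇ n (P m) - ∑ (suc m) h         ≡⟨ cong (_-_ (∇ n (P m))) (∑-last m h) ⟩
  ∇ n (P m) - (∑ m h + + (m C m) * ∇ n (P m))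
    ≡⟨ cong (λ c → ∇ n (P m) - (∑ m h + + c * ∇ n (P m))) (nCn≡1 m) ⟩
  ∇ n (P m) - (∑ m h + + 1 * ∇ n (P m)) ≡⟨ cancel (∇ n (P m)) (∑ m h) ⟩
  - ∑ m h ∎
  where
  open ≡-Reasoning
  P : ℕ → ℕ → ℤ
  P j k = (+ k + a) ^ j
  h : ℕ → ℤ
  h j = + (m C j) * ∇ n (P j)
  cancel : ∀ e s → e - (s + + 1 * e) ≡ - s
  cancel = solve-∀
  shift : ∀ k → + suc k + a ≡ (+ k + a) + + 1
  shift k = trans (cong (_+ a) (pos-suc k)) (reassoc (+ k) a)
    where
    reassoc : ∀ x a → x + + 1 + a ≡ x + a + + 1
    reassoc = solve-∀
  shifted : ∇ n (λ k → P m (suc k)) ≡ ∑ (suc m) h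
  shifted = begin
    ∇ n (λ k → P m (suc k))
      ≡⟨ ∇-cong n (λ k → trans (cong (_^ m) (shift k)) (binomialTheorem (+ k + a) m)) ⟩
    ∇ n (λ k → ∑ (suc m) (λ j → P j k * + (m C j)))
      ≡⟨ ∇-∑ n (suc m) (λ j k → P j k * + (m C j)) ⟩
    ∑ (suc m) (λ j → ∇ n (λ k → P j k * + (m C j)))
      ≡⟨ ∑-cong (suc m) (λ j _ → trans (∇-cong n (λ k → ℤP.*-comm (P j k) (+ (m C j)))) (∇-*ˡ n (+ (m C j)) (P j))) ⟩
    ∑ (suc m) h ∎

∇-power< : ∀ n m a → m ℕ.< n → ∇ n (λ k → (+ k + a) ^ m) ≡ + 0
∇-power< (suc n) m a m<1+n = trans (∇-power-suc n m a) (cong -_ (∑-zero m (λ j j<m →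
  trans (cong (+ (m C j) *_) (∇-power< n j a (ℕP.<-≤-trans j<m (ℕP.≤-pred m<1+n)))) (ℤP.*-zeroʳ (+ (m C j))))))

∇-power≡ : ∀ n a → ∇ n (λ k → (+ k + a) ^ n) ≡ -1ℤ ^ n * + (n !)
∇-power≡ zero    a = refl
∇-power≡ (suc n) a = begin
  ∇ (suc n) (P (suc n))             ≡⟨ ∇-power-suc n (suc n) a ⟩
  - ∑ (suc n) h                     ≡⟨ cong -_ (∑-last n h) ⟩
  - (∑ n h + h n)                   ≡⟨ cong (λ s → - (s + h n)) (∑-zero n (λ j j<n →
                                         trans (cong (+ (suc n C j) *_) (∇-power< n j a j<n)) (ℤP.*-zeroʳ (+ (suc n C j))))) ⟩
  - (+ 0 + h n)                     ≡⟨ cong₂ (λ c d → - (+ 0 + + c * d)) ([1+n]Cn≡1+n n) (∇-power≡ n a) ⟩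
  - (+ 0 + + suc n * (-1ℤ ^ n * + (n !))) ≡⟨ regroup (+ suc n) (-1ℤ ^ n) (+ (n !)) ⟩
  -1ℤ * -1ℤ ^ n * (+ suc n * + (n !))    ≡⟨ cong (-1ℤ * -1ℤ ^ n *_) (ℤP.pos-* (suc n) (n !)) ⟨
  -1ℤ ^ suc n * + (suc n !) ∎
  where
  open ≡-Reasoning
  P : ℕ → ℕ → ℤ
  P j k = (+ k + a) ^ j
  h : ℕ → ℤ
  h j = + (suc n C j) * ∇ n (P j)
  regroup : ∀ c s f → - (+ 0 + c * (s * f)) ≡ -1ℤ * s * (c * f)
  regroup = solve-∀

-- The Legendre symbol (m / 3) and the sums Aᵣ

χ₃ : ℕ → ℤ
χ₃ 0                   = + 0
χ₃ 1                   = + 1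
χ₃ 2                   = -1ℤ
χ₃ (suc (suc (suc m))) = χ₃ m

χ₃-periodic : ∀ r j → χ₃ (r ℕ.+ 3 ℕ.* j) ≡ χ₃ r
χ₃-periodic r zero    = cong χ₃ (ℕP.+-identityʳ r)
χ₃-periodic r (suc j) = trans (cong χ₃ (unfold r j)) (χ₃-periodic r j)
  where
  unfold : ∀ r j → r ℕ.+ 3 ℕ.* suc j ≡ 3 ℕ.+ (r ℕ.+ 3 ℕ.* j)
  unfold = ℕ-solve-∀

module _ (G : ℕ → ℤ) where

  private
    S : ℕ → ℤ
    S N = ∑ N (λ m → χ₃ (suc m) * G (suc m))
    G₁ G₂ : ℕ → ℤ
    G₁ j = G (1 ℕ.+ 3 ℕ.* j)
    G₂ j = G (2 ℕ.+ 3 ℕ.* j)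

  χ₃-split₀ : ∀ j → S (3 ℕ.* j) ≡ ∑ j G₁ - ∑ j G₂
  χ₃-split₁ : ∀ j → S (1 ℕ.+ 3 ℕ.* j) ≡ ∑ (suc j) G₁ - ∑ j G₂
  χ₃-split₂ : ∀ j → S (2 ℕ.+ 3 ℕ.* j) ≡ ∑ (suc j) G₁ - ∑ (suc j) G₂

  χ₃-split₀ zero    = refl
  χ₃-split₀ (suc j) = begin
    S (3 ℕ.* suc j)
      ≡⟨ cong S (ℕP.*-suc 3 j) ⟩
    S (3 ℕ.+ 3 ℕ.* j)
      ≡⟨ ∑-last (2 ℕ.+ 3 ℕ.* j) (λ m → χ₃ (suc m) * G (suc m)) ⟩
    S (2 ℕ.+ 3 ℕ.* j) + χ₃ (3 ℕ.* j) * G (3 ℕ.+ 3 ℕ.* j)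
      ≡⟨ cong₂ (λ s c → s + c * G (3 ℕ.+ 3 ℕ.* j)) (χ₃-split₂ j) (χ₃-periodic 0 j) ⟩
    ∑ (suc j) G₁ - ∑ (suc j) G₂ + + 0 * G (3 ℕ.+ 3 ℕ.* j)
      ≡⟨ drop-zero (∑ (suc j) G₁ - ∑ (suc j) G₂) (G (3 ℕ.+ 3 ℕ.* j)) ⟩
    ∑ (suc j) G₁ - ∑ (suc j) G₂ ∎
    where
    open ≡-Reasoning
    drop-zero : ∀ s g → s + + 0 * g ≡ s
    drop-zero = solve-∀
  χ₃-split₁ j = begin
    S (1 ℕ.+ 3 ℕ.* j)                       ≡⟨ ∑-last (3 ℕ.* j) (λ m → χ₃ (suc m) * G (suc m)) ⟩
    S (3 ℕ.* j) + χ₃ (1 ℕ.+ 3 ℕ.* j) * G₁ j ≡⟨ cong₂ (λ s c → s + c * G₁ j) (χ₃-split₀ j) (χ₃-periodic 1 j) ⟩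
    ∑ j G₁ - ∑ j G₂ + + 1 * G₁ j            ≡⟨ regroup (∑ j G₁) (∑ j G₂) (G₁ j) ⟩
    (∑ j G₁ + G₁ j) - ∑ j G₂                ≡⟨ cong (_- ∑ j G₂) (∑-last j G₁) ⟨
    ∑ (suc j) G₁ - ∑ j G₂ ∎
    where
    open ≡-Reasoning
    regroup : ∀ a b g → a - b + + 1 * g ≡ (a + g) - b
    regroup = solve-∀
  χ₃-split₂ j = begin
    S (2 ℕ.+ 3 ℕ.* j)
      ≡⟨ ∑-last (1 ℕ.+ 3 ℕ.* j) (λ m → χ₃ (suc m) * G (suc m)) ⟩
    S (1 ℕ.+ 3 ℕ.* j) + χ₃ (2 ℕ.+ 3 ℕ.* j) * G₂ j
      ≡⟨ cong₂ (λ s c → s + c * G₂ j) (χ₃-split₁ j) (χ₃-periodic 2 j) ⟩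
    ∑ (suc j) G₁ - ∑ j G₂ + -1ℤ * G₂ j
      ≡⟨ regroup (∑ (suc j) G₁) (∑ j G₂) (G₂ j) ⟩
    ∑ (suc j) G₁ - (∑ j G₂ + G₂ j)
      ≡⟨ cong (_-_ (∑ (suc j) G₁)) (∑-last j G₂) ⟨
    ∑ (suc j) G₁ - ∑ (suc j) G₂ ∎
    where
    open ≡-Reasoning
    regroup : ∀ a b g → a - b + -1ℤ * g ≡ a - (b + g)
    regroup = solve-∀

  χ₃-split : ∀ N → S N ≡ ∑ ((N ℕ.+ 2) ℕ./ 3) G₁ - ∑ ((N ℕ.+ 1) ℕ./ 3) G₂
  χ₃-split N with residue3 N
  ... | j , inj₁ refl        = trans (χ₃-split₀ j) (sym (cong₂ (λ a b → ∑ a G₁ - ∑ b G₂)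
    ([r+3j]/3≡j 2 j ℕP.≤-refl (eq₀₂ j)) ([r+3j]/3≡j 1 j (ℕ.s<s ℕ.z<s) (eq₀₁ j))))
    where
    eq₀₂ : ∀ j → 3 ℕ.* j ℕ.+ 2 ≡ 2 ℕ.+ 3 ℕ.* j
    eq₀₂ = ℕ-solve-∀
    eq₀₁ : ∀ j → 3 ℕ.* j ℕ.+ 1 ≡ 1 ℕ.+ 3 ℕ.* j
    eq₀₁ = ℕ-solve-∀
  ... | j , inj₂ (inj₁ refl) = trans (χ₃-split₁ j) (sym (cong₂ (λ a b → ∑ a G₁ - ∑ b G₂)
    ([r+3j]/3≡j 0 (suc j) ℕ.z<s (eq₁₂ j)) ([r+3j]/3≡j 2 j ℕP.≤-refl (eq₁₁ j))))
    where
    eq₁₂ : ∀ j → 1 ℕ.+ 3 ℕ.* j ℕ.+ 2 ≡ 0 ℕ.+ 3 ℕ.* suc j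
    eq₁₂ = ℕ-solve-∀
    eq₁₁ : ∀ j → 1 ℕ.+ 3 ℕ.* j ℕ.+ 1 ≡ 2 ℕ.+ 3 ℕ.* j
    eq₁₁ = ℕ-solve-∀
  ... | j , inj₂ (inj₂ refl) = trans (χ₃-split₂ j) (sym (cong₂ (λ a b → ∑ a G₁ - ∑ b G₂)
    ([r+3j]/3≡j 1 (suc j) (ℕ.s<s ℕ.z<s) (eq₂₂ j)) ([r+3j]/3≡j 0 (suc j) ℕ.z<s (eq₂₁ j))))
    where
    eq₂₂ : ∀ j → 2 ℕ.+ 3 ℕ.* j ℕ.+ 2 ≡ 1 ℕ.+ 3 ℕ.* suc j
    eq₂₂ = ℕ-solve-∀
    eq₂₁ : ∀ j → 2 ℕ.+ 3 ℕ.* j ℕ.+ 1 ≡ 0 ℕ.+ 3 ℕ.* suc j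
    eq₂₁ = ℕ-solve-∀

binomialTransform-2^-suc : ∀ (f : ℕ → ℤ) n →
  binomialTransform (λ m → f m * (+ 2) ^ m) (suc n)
    ≡ binomialTransform (λ m → f m * (+ 2) ^ m) n + + 2 * binomialTransform (λ m → f (suc m) * (+ 2) ^ m) n
binomialTransform-2^-suc f n = trans (binomialTransform-suc (λ m → f m * (+ 2) ^ m) n)
  (cong (_+_ (binomialTransform (λ m → f m * (+ 2) ^ m) n)) (trans
    (∑-cong (suc n) (λ m _ → pull-2 (f (suc m)) ((+ 2) ^ m) (+ (n C m))))
    (∑-distribˡ-* (suc n) (+ 2) (λ m → f (suc m) * (+ 2) ^ m * + (n C m)))))
  where
  pull-2 : ∀ a b c → a * (+ 2 * b) * c ≡ + 2 * (a * b * c)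
  pull-2 = solve-∀

A₀ A₁ A₂ : ℕ → ℤ
A₀ = binomialTransform (λ m → χ₃ m * (+ 2) ^ m)
A₁ = binomialTransform (λ m → χ₃ (suc m) * (+ 2) ^ m)
A₂ = binomialTransform (λ m → χ₃ (suc (suc m)) * (+ 2) ^ m)

A₀+A₁+A₂≡0 : ∀ n → A₀ n + A₁ n + A₂ n ≡ + 0
A₀+A₁+A₂≡0 zero    = refl
A₀+A₁+A₂≡0 (suc n) = begin
  A₀ (suc n) + A₁ (suc n) + A₂ (suc n)
    ≡⟨ cong₂ _+_ (cong₂ _+_ (binomialTransform-2^-suc χ₃ n) (binomialTransform-2^-suc (λ m → χ₃ (suc m)) n))
                 (binomialTransform-2^-suc (λ m → χ₃ (suc (suc m))) n) ⟩
  (A₀ n + + 2 * A₁ n) + (A₁ n + + 2 * A₂ n) + (A₂ n + + 2 * A₀ n)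
    ≡⟨ triple (A₀ n) (A₁ n) (A₂ n) ⟩
  + 3 * (A₀ n + A₁ n + A₂ n)
    ≡⟨ cong (+ 3 *_) (A₀+A₁+A₂≡0 n) ⟩
  + 0 ∎
  where
  open ≡-Reasoning
  triple : ∀ a b c → (a + + 2 * b) + (b + + 2 * c) + (c + + 2 * a) ≡ + 3 * (a + b + c)
  triple = solve-∀

A₀[2+n]≡-3*A₀[n] : ∀ n → A₀ (suc (suc n)) ≡ -[1+ 2 ] * A₀ n
A₀[2+n]≡-3*A₀[n] n = begin
  A₀ (suc (suc n))
    ≡⟨ binomialTransform-2^-suc χ₃ (suc n) ⟩
  A₀ (suc n) + + 2 * A₁ (suc n)
    ≡⟨ cong₂ (λ x y → x + + 2 * y) (binomialTransform-2^-suc χ₃ n) (binomialTransform-2^-suc (λ m → χ₃ (suc m)) n) ⟩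
  (A₀ n + + 2 * A₁ n) + + 2 * (A₁ n + + 2 * A₂ n)
    ≡⟨ regroup (A₀ n) (A₁ n) (A₂ n) ⟩
  A₀ n + + 4 * (A₀ n + A₁ n + A₂ n) - + 4 * A₀ n
    ≡⟨ cong (λ s → A₀ n + + 4 * s - + 4 * A₀ n) (A₀+A₁+A₂≡0 n) ⟩
  A₀ n + + 4 * + 0 - + 4 * A₀ n
    ≡⟨ collapse (A₀ n) ⟩
  -[1+ 2 ] * A₀ n ∎
  where
  open ≡-Reasoning
  regroup : ∀ a b c → (a + + 2 * b) + + 2 * (b + + 2 * c) ≡ a + + 4 * (a + b + c) - + 4 * a
  regroup = solve-∀
  collapse : ∀ a → a + + 4 * + 0 - + 4 * a ≡ -[1+ 2 ] * a
  collapse = solve-∀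

A₀[1+2h]≡2*[-3]^h : ∀ h → A₀ (suc (h ℕ.+ h)) ≡ + 2 * -[1+ 2 ] ^ h
A₀[1+2h]≡2*[-3]^h zero    = refl
A₀[1+2h]≡2*[-3]^h (suc h) = begin
  A₀ (suc (suc h ℕ.+ suc h))      ≡⟨ cong (λ n → A₀ (suc (suc n))) (ℕP.+-suc h h) ⟩
  A₀ (suc (suc (suc (h ℕ.+ h))))  ≡⟨ A₀[2+n]≡-3*A₀[n] (suc (h ℕ.+ h)) ⟩
  -[1+ 2 ] * A₀ (suc (h ℕ.+ h))   ≡⟨ cong (-[1+ 2 ] *_) (A₀[1+2h]≡2*[-3]^h h) ⟩
  -[1+ 2 ] * (+ 2 * -[1+ 2 ] ^ h) ≡⟨ swap -[1+ 2 ] (-[1+ 2 ] ^ h) ⟩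
  + 2 * -[1+ 2 ] ^ suc h ∎
  where
  open ≡-Reasoning
  swap : ∀ a t → a * (+ 2 * t) ≡ + 2 * (a * t)
  swap = solve-∀

characterSum : ℕ → ℤ
characterSum p = ∑ (p ℕ.∸ 1) (λ m → χ₃ (suc m) * (+ 2) ^ suc m * + (p C suc m))

characterSum≡A₀-χ₃2ᵖ : ∀ P → characterSum (suc P) ≡ A₀ (suc P) - χ₃ (suc P) * (+ 2) ^ suc P
characterSum≡A₀-χ₃2ᵖ P = sym (begin
  + 0 + ∑ (suc P) g - c
    ≡⟨ cong (λ s → + 0 + s - c) (∑-last P g) ⟩
  + 0 + (characterSum (suc P) + χ₃ (suc P) * (+ 2) ^ suc P * + (suc P C suc P)) - c
    ≡⟨ cong (λ k → + 0 + (characterSum (suc P) + c * + k) - c) (nCn≡1 (suc P)) ⟩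
  + 0 + (characterSum (suc P) + c * + 1) - c
    ≡⟨ cancel (characterSum (suc P)) c ⟩
  characterSum (suc P) ∎)
  where
  open ≡-Reasoning
  g : ℕ → ℤ
  g m = χ₃ (suc m) * (+ 2) ^ suc m * + (suc P C suc m)
  c = χ₃ (suc P) * (+ 2) ^ suc P
  cancel : ∀ s c → + 0 + (s + c * + 1) - c ≡ s
  cancel = solve-∀

characterSum[1+2h] : ∀ h →
  characterSum (suc (h ℕ.+ h)) ≡ + 2 * -[1+ 2 ] ^ h - χ₃ (suc (h ℕ.+ h)) * (+ 2) ^ suc (h ℕ.+ h)
characterSum[1+2h] h = trans (characterSum≡A₀-χ₃2ᵖ (h ℕ.+ h))
  (cong (_- χ₃ (suc (h ℕ.+ h)) * (+ 2) ^ suc (h ℕ.+ h)) (A₀[1+2h]≡2*[-3]^h h))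

p∣characterSum : ∀ {p} → Prime p → + p ∣ characterSum p
p∣characterSum {suc P} p-prime = ∣∑ P (λ m m<P →
  ℤ∣.∣n⇒∣m*n (χ₃ (suc m) * (+ 2) ^ suc m) (p∣pC[1+k] p-prime m (ℕ.s<s m<P)))

-- Euler's criterion for -3, obtained from p ∣ Σ_{0<m<p} χ₃(m) 2ᵐ C(p,m) and 2ᵖ ≡ 2.
euler[-3] : ∀ {p h} → Prime p → p ≡ suc (h ℕ.+ h) → + p ∣ -[1+ 2 ] ^ h - χ₃ p
euler[-3] {p} {h} p-prime refl = ∣-*-cancelˡ p-prime (∤-small (odd-prime>2 {h} p-prime)) p∣2[t-c]
  where
  t = -[1+ 2 ] ^ h
  c = χ₃ p
  combine : ∀ t c x → (+ 2 * t - c * x) + c * (x - + 2) ≡ + 2 * (t - c)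
  combine = solve-∀
  p∣characterSum′ : + p ∣ + 2 * t - c * (+ 2) ^ p
  p∣characterSum′ = subst (+ p ∣_) (characterSum[1+2h] h) (p∣characterSum p-prime)
  p∣2[t-c] : + p ∣ + 2 * (t - c)
  p∣2[t-c] = subst (+ p ∣_) (combine t c ((+ 2) ^ p))
    (ℤ∣.∣m∣n⇒∣m+n p∣characterSum′ (ℤ∣.∣n⇒∣m*n c (fermat p-prime 2)))

-- The Legendre symbol (-3 / p)

-- x ↦ xⁿ - 1 cannot vanish at the n + 1 points 1, …, n + 1, since its n-th difference is ±n!.
∃-nonRoot : ∀ {p} → Prime p → ∀ n → 0 ℕ.< n → n ℕ.< p →
  ∃ λ a → a ℕ.≤ n × ¬ (+ p ∣ (+ a + + 1) ^ n - + 1)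
∃-nonRoot {p} p-prime n 0<n n<p =
  let i , ¬root = ¬∀⟶∃¬ (suc n) Root (λ i → + p ∣? (+ toℕ i + + 1) ^ n - + 1) ¬allRoots
  in  toℕ i , ℕP.≤-pred (toℕ<n i) , ¬root
  where
  Root : Fin (suc n) → Set
  Root i = + p ∣ (+ toℕ i + + 1) ^ n - + 1
  ∇≡±n! : ∇ n (λ k → (+ k + + 1) ^ n - (+ k + + 1) ^ 0) ≡ -1ℤ ^ n * + (n !)
  ∇≡±n! = trans (∇-sub n (λ k → (+ k + + 1) ^ n) (λ k → (+ k + + 1) ^ 0))
    (trans (cong₂ _-_ (∇-power≡ n (+ 1)) (∇-power< n 0 (+ 1) 0<n)) (ℤP.+-identityʳ _))
  ¬allRoots : ¬ (∀ i → Root i)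
  ¬allRoots roots = p∤n! p-prime n<p (ℤ∣.∣⇒∣ᵤ (subst (+ p ∣_) unsign (ℤ∣.∣n⇒∣m*n (-1ℤ ^ n) p∣±n!)))
    where
    root : ∀ k → k ℕ.< suc n → + p ∣ (+ k + + 1) ^ n - + 1
    root k k<1+n = subst (λ m → + p ∣ (+ m + + 1) ^ n - + 1) (toℕ-fromℕ< k<1+n) (roots (fromℕ< k<1+n))
    p∣±n! : + p ∣ -1ℤ ^ n * + (n !)
    p∣±n! = subst (+ p ∣_) ∇≡±n! (∣∑ (suc n) (λ k k<1+n →
      ℤ∣.∣m⇒∣m*n (+ (n C k)) (ℤ∣.∣n⇒∣m*n (-1ℤ ^ k) (root k k<1+n))))
    unsign : -1ℤ ^ n * (-1ℤ ^ n * + (n !)) ≡ + (n !)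
    unsign = trans (sym (ℤP.*-assoc (-1ℤ ^ n) _ _)) (trans (cong (_* + (n !)) ([-1]^n*[-1]^n≡1 n)) (ℤP.*-identityˡ _))

sqrt-%ℕ : ∀ p .{{_ : ℕ.NonZero p}} → ∀ z {c} → + p ∣ z * z - c → + p ∣ + (z %ℕ p) * + (z %ℕ p) - c
sqrt-%ℕ p z {c} p∣ = subst (+ p ∣_) (difference z x c)
  (ℤ∣.∣m∣n⇒∣m-n p∣ (ℤ∣.∣n⇒∣m*n (z + x) (divides (z /ℕ p) z-x≡)))
  where
  x = + (z %ℕ p)
  z-x≡ : z - x ≡ z /ℕ p * + p
  z-x≡ = trans (cong (_- x) (a≡a%ℕn+[a/ℕn]*n z p)) (cancel x (z /ℕ p * + p))
    where
    cancel : ∀ a b → a + b - a ≡ b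
    cancel = solve-∀
  difference : ∀ z x c → (z * z - c) - (z + x) * (z - x) ≡ x * x - c
  difference = solve-∀

-- b = (a + 1)ⁿ is a cube root of unity other than 1, so p ∣ b² + b + 1 and (2b + 1)² ≡ -3.
sqrt[-3] : ∀ {p} → Prime p → ∀ n → 0 ℕ.< n → p ≡ 1 ℕ.+ 3 ℕ.* n → ∃ λ z → + p ∣ z * z - -[1+ 2 ]
sqrt[-3] {p} p-prime n 0<n p≡ = + 2 * b + + 1 , subst (+ p ∣_) (complete-square b) (ℤ∣.∣n⇒∣m*n (+ 4) p∣b²+b+1)
  where
  n<p : n ℕ.< p
  n<p = subst (n ℕ.<_) (sym p≡) (ℕ.s≤s (ℕP.m≤m+n n (2 ℕ.* n)))
  nonRoot = ∃-nonRoot p-prime n 0<n n<p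
  a = proj₁ nonRoot
  b = (+ a + + 1) ^ n
  1+a<p : suc a ℕ.< p
  1+a<p = subst (suc a ℕ.<_) (sym p≡)
    (ℕ.s<s (ℕP.≤-<-trans (proj₁ (proj₂ nonRoot)) (ℕP.m<m+n n (ℕP.<-≤-trans 0<n (ℕP.m≤m+n n (n ℕ.+ 0))))))
  b³≡ : (+ suc a) ^ (p ℕ.∸ 1) ≡ b * (b * (b * + 1))
  b³≡ = trans (cong (λ m → (+ suc a) ^ (m ℕ.∸ 1)) p≡)
    (trans (cong (_^ (3 ℕ.* n)) (pos-suc a))
    (trans (cong ((+ a + + 1) ^_) (ℕP.*-comm 3 n)) (sym (ℤP.^-*-assoc (+ a + + 1) n 3))))
  p∣b³-1 : + p ∣ b * (b * (b * + 1)) - + 1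
  p∣b³-1 = subst (λ y → + p ∣ y - + 1) b³≡ (fermat′ p-prime (∤-small 1+a<p))
  cube-1 : ∀ b → b * (b * (b * + 1)) - + 1 ≡ (b - + 1) * (b * b + b + + 1)
  cube-1 = solve-∀
  p∣b²+b+1 : + p ∣ b * b + b + + 1
  p∣b²+b+1 = ∣-*-cancelˡ p-prime (proj₂ (proj₂ nonRoot)) (subst (+ p ∣_) (cube-1 b) p∣b³-1)
  complete-square : ∀ b → + 4 * (b * b + b + + 1) ≡ (+ 2 * b + + 1) * (+ 2 * b + + 1) - -[1+ 2 ]
  complete-square = solve-∀

-- A root x would give 1 ≡ x^(p-1) = (x²)^h ≡ (-3)^h ≡ χ₃(p) = -1.
no-sqrt[-3] : ∀ {p h} → Prime p → 3 ℕ.< p → p ≡ suc (h ℕ.+ h) → χ₃ p ≡ -1ℤ →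
  ∀ x → ¬ (+ p ∣ + x * + x - -[1+ 2 ])
no-sqrt[-3] {p} {h} p-prime 3<p refl χ₃p≡-1 x p∣x²+3 = ∤-small (ℕP.<-trans (ℕP.n<1+n 2) 3<p) (ℤ∣.∣m⇒∣-m p∣-2)
  where
  p∤x : ¬ (+ p ∣ + x)
  p∤x p∣x = ∤-small 3<p (ℤ∣.∣m⇒∣-m (subst (+ p ∣_) (cancel (+ x * + x))
    (ℤ∣.∣m∣n⇒∣m-n (ℤ∣.∣n⇒∣m*n (+ x) p∣x) p∣x²+3)))
    where
    cancel : ∀ y → y - (y - -[1+ 2 ]) ≡ -[1+ 2 ]
    cancel = solve-∀
  X T : ℤ
  X = (+ x * + x) ^ h
  T = -[1+ 2 ] ^ h
  p∣X-1 : + p ∣ X - + 1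
  p∣X-1 = subst (λ y → + p ∣ y - + 1) (sym ([a*a]^h≡a^[h+h] (+ x) h)) (fermat′ p-prime p∤x)
  telescope : ∀ X T c → (X - + 1) - (X - T) - (T - c) ≡ c - + 1
  telescope = solve-∀
  p∣-2 : + p ∣ -[1+ 1 ]
  p∣-2 = subst (+ p ∣_) (trans (telescope X T (χ₃ p)) (cong (_- + 1) χ₃p≡-1))
    (ℤ∣.∣m∣n⇒∣m-n (ℤ∣.∣m∣n⇒∣m-n p∣X-1 (∣-^ (+ x * + x) -[1+ 2 ] h p∣x²+3)) (euler[-3] {h = h} p-prime refl))

module _ {p} (p-prime : Prime p) (3<p : 3 ℕ.< p) where

  private
    instance
      p≢0 : ℕ.NonZero p
      p≢0 = prime⇒nonZero p-prime

    2<p : 2 ℕ.< p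
    2<p = ℕP.<-trans (ℕP.n<1+n 2) 3<p

  root⇒χ₃≡1 : (∃ λ x → + p ∣ + x * + x - -[1+ 2 ]) → χ₃ p ≡ + 1
  root⇒χ₃≡1 (x , p∣) = byResidue (prime-mod3 p-prime 3<p)
    where
    byResidue : ∃ (λ j → p ≡ 1 ℕ.+ 3 ℕ.* j ⊎ p ≡ 2 ℕ.+ 3 ℕ.* j) → χ₃ p ≡ + 1
    byResidue (j , inj₁ p≡) = trans (cong χ₃ p≡) (χ₃-periodic 1 j)
    byResidue (j , inj₂ p≡) =
      let h , p≡2h+1 = prime-odd p-prime 2<p
      in  ⊥-elim (no-sqrt[-3] {h = h} p-prime 3<p p≡2h+1 (trans (cong χ₃ p≡) (χ₃-periodic 2 j)) x p∣)

  noRoot⇒χ₃≡-1 : (∀ x → x ℕ.< p → ¬ (+ p ∣ + x * + x - -[1+ 2 ])) → χ₃ p ≡ -1ℤ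
  noRoot⇒χ₃≡-1 noRoot = byResidue (prime-mod3 p-prime 3<p)
    where
    byResidue : ∃ (λ j → p ≡ 1 ℕ.+ 3 ℕ.* j ⊎ p ≡ 2 ℕ.+ 3 ℕ.* j) → χ₃ p ≡ -1ℤ
    byResidue (j     , inj₂ p≡) = trans (cong χ₃ p≡) (χ₃-periodic 2 j)
    byResidue (zero  , inj₁ p≡) = ⊥-elim (ℕP.<-irrefl (sym p≡) (ℕP.<-trans (ℕP.n<1+n 1) 2<p))
    byResidue (suc j , inj₁ p≡) =
      let z , p∣z²+3 = sqrt[-3] p-prime (suc j) ℕ.z<s p≡
      in  ⊥-elim (noRoot (z %ℕ p) (n%ℕd<d z p) (sqrt-%ℕ p z { -[1+ 2 ] } p∣z²+3))

  legendre[-3] : legendre -[1+ 2 ] p ≡ χ₃ p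
  legendre[-3] with + p ∣? -[1+ 2 ]
  ... | yes p∣-3 = ⊥-elim (∤-small 3<p (ℤ∣.∣m⇒∣-m p∣-3))
  ... | no _ with any? (λ x → + p ∣? + x * + x - -[1+ 2 ]) (upTo p)
  ...   | yes root = sym (root⇒χ₃≡1 (satisfied root))
  ...   | no ¬root = sym (noRoot⇒χ₃≡-1 (λ x x<p p∣ → ¬root (lose (∈-upTo⁺ x<p) p∣)))

-- Fractions and congruences in ℤ₍ₚ₎

/-cross : ∀ N₁ D₁ N₂ D₂ → N₁ * + suc D₂ ≡ N₂ * + suc D₁ → N₁ / suc D₁ ≡ N₂ / suc D₂
/-cross N₁ D₁ N₂ D₂ eq = ℚP.fromℚᵘ-cong {mkℚᵘ N₁ D₁} {mkℚᵘ N₂ D₂} (*≡* eq)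

/-+-/ : ∀ N₁ D₁ N₂ D₂ →
  N₁ / suc D₁ ℚ.+ N₂ / suc D₂ ≡ (N₁ * + suc D₂ ℤ.+ N₂ * + suc D₁) / (suc D₁ ℕ.* suc D₂)
/-+-/ N₁ D₁ N₂ D₂ = trans (sym (ℚP.fromℚᵘ-toℚᵘ _)) (ℚP.fromℚᵘ-cong (ℚᵘP.≃-trans
  (ℚP.toℚᵘ-homo-+ (N₁ / suc D₁) (N₂ / suc D₂))
  (ℚᵘP.+-cong (ℚP.toℚᵘ-fromℚᵘ (mkℚᵘ N₁ D₁)) (ℚP.toℚᵘ-fromℚᵘ (mkℚᵘ N₂ D₂)))))

/-*-/ : ∀ N₁ D₁ N₂ D₂ → (N₁ / suc D₁) ℚ.* (N₂ / suc D₂) ≡ (N₁ * N₂) / (suc D₁ ℕ.* suc D₂)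
/-*-/ N₁ D₁ N₂ D₂ = trans (sym (ℚP.fromℚᵘ-toℚᵘ _)) (ℚP.fromℚᵘ-cong (ℚᵘP.≃-trans
  (ℚP.toℚᵘ-homo-* (N₁ / suc D₁) (N₂ / suc D₂))
  (ℚᵘP.*-cong (ℚP.toℚᵘ-fromℚᵘ (mkℚᵘ N₁ D₁)) (ℚP.toℚᵘ-fromℚᵘ (mkℚᵘ N₂ D₂)))))

-‿/ : ∀ N D → ℚ.- (N / suc D) ≡ (ℤ.- N) / suc D
-‿/ N D = trans (sym (ℚP.fromℚᵘ-toℚᵘ _)) (ℚP.fromℚᵘ-cong (ℚᵘP.≃-trans
  (ℚP.toℚᵘ-homo‿- (N / suc D))
  (ℚᵘP.-‿cong (ℚP.toℚᵘ-fromℚᵘ (mkℚᵘ N D)))))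

↥*≡*↧ : ∀ x N D → x ≡ N / suc D → ↥ x * + suc D ≡ N * ↧ x
↥*≡*↧ x N D refl with ℚP.toℚᵘ-fromℚᵘ (mkℚᵘ N D)
... | *≡* eq = trans (cong (_* + suc D) (sym (ℚP.↥ᵘ-toℚᵘ x))) (trans eq (cong (N *_) (ℚP.↧ᵘ-toℚᵘ x)))

/-+-/-same : ∀ A B D → A / suc D ℚ.+ B / suc D ≡ (A ℤ.+ B) / suc D
/-+-/-same A B D = trans (/-+-/ A D B D) (/-cross (A * d ℤ.+ B * d) (D ℕ.+ D ℕ.* suc D) (A ℤ.+ B) D eq)
  where
  d = + suc D
  factor : ∀ a b d → (a * d ℤ.+ b * d) * d ≡ (a ℤ.+ b) * (d * d)
  factor = solve-∀
  eq : (A * d ℤ.+ B * d) * d ≡ (A ℤ.+ B) * + (suc D ℕ.* suc D)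
  eq = trans (factor A B d) (cong ((A ℤ.+ B) *_) (sym (ℤP.pos-* (suc D) (suc D))))

-/-same : ∀ A B D → A / suc D ℚ.- B / suc D ≡ (A ℤ.- B) / suc D
-/-same A B D = trans (cong (A / suc D ℚ.+_) (-‿/ B D)) (/-+-/-same A (ℤ.- B) D)

/1-*-/ : ∀ a N D → (a / 1) ℚ.* (N / suc D) ≡ (a * N) / suc D
/1-*-/ a N D = trans (/-*-/ a 0 N D) (/-cross (a * N) (D ℕ.+ 0) (a * N) D
  (cong (λ d → a * N * + suc d) (sym (ℕP.+-identityʳ D))))

-- In the application b = C(p, m₁), b′ = C(p-1, m₁-1) and u = (-1)^(m₁-1).
binomial-cross : ∀ a p u s b b′ m₁ → b * m₁ ≡ p * b′ → b′ ≡ u + s * p → u * u ≡ + 1 →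
  (a * p + - (u * a * b) * m₁) * m₁ ≡ - (u * a * s * p * (m₁ * p))
binomial-cross a p u s b b′ m₁ bm₁≡pb′ refl u²≡1 = begin
  (a * p + - (u * a * b) * m₁) * m₁            ≡⟨ expand a p u b m₁ ⟩
  a * p * m₁ - u * a * (b * m₁) * m₁           ≡⟨ cong (λ x → a * p * m₁ - u * a * x * m₁) bm₁≡pb′ ⟩
  a * p * m₁ - u * a * (p * (u + s * p)) * m₁  ≡⟨ regroup a p u s m₁ ⟩
  a * p * m₁ * (+ 1 - u * u) - e               ≡⟨ cong (λ x → a * p * m₁ * (+ 1 - x) - e) u²≡1 ⟩
  a * p * m₁ * (+ 1 - + 1) - e                 ≡⟨ finish (a * p * m₁) e ⟩
  - e ∎
  where
  open ≡-Reasoning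
  e = u * a * s * p * (m₁ * p)
  expand : ∀ a p u b m₁ → (a * p + - (u * a * b) * m₁) * m₁ ≡ a * p * m₁ - u * a * (b * m₁) * m₁
  expand = solve-∀
  regroup : ∀ a p u s m₁ →
    a * p * m₁ - u * a * (p * (u + s * p)) * m₁ ≡ a * p * m₁ * (+ 1 - u * u) - u * a * s * p * (m₁ * p)
  regroup = solve-∀
  finish : ∀ x e → x * (+ 1 - + 1) - e ≡ - e
  finish = solve-∀

module PIntegral {P : ℕ} (p-prime : Prime (suc P)) where

  private
    p = suc P

  1<p : 1 ℕ.< p
  1<p = ℕ.nonTrivial⇒n>1 p {{prime⇒nonTrivial p-prime}}

  pℤ₍ₚ₎ : ℚ → Set
  pℤ₍ₚ₎ x = ∃₂ λ N D → + p ∣ N × ¬ (+ p ∣ + suc D) × x ≡ N / suc D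

  -- Congruence mod p in ℤ₍ₚ₎ read off an arbitrary representing fraction, so that, unlike
  -- _≡_[modℚ_], it is visibly closed under addition; ≈⇒≡[modℚ] converts at the end.
  infix 4 _≈_
  record _≈_ (x y : ℚ) : Set where
    constructor ≈-intro
    field difference : pℤ₍ₚ₎ (x ℚ.- y)

  pℤ₍ₚ₎-0 : pℤ₍ₚ₎ ℚ.0ℚ
  pℤ₍ₚ₎-0 = + 0 , 0 , divides (+ 0) refl , ∤-small 1<p , sym (ℚP.0/n≡0 1)

  pℤ₍ₚ₎-+ : ∀ {x y} → pℤ₍ₚ₎ x → pℤ₍ₚ₎ y → pℤ₍ₚ₎ (x ℚ.+ y)
  pℤ₍ₚ₎-+ (N₁ , D₁ , p∣N₁ , p∤D₁ , refl) (N₂ , D₂ , p∣N₂ , p∤D₂ , refl) =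
    N₁ * + suc D₂ + N₂ * + suc D₁ , D₂ ℕ.+ D₁ ℕ.* suc D₂ ,
    ℤ∣.∣m∣n⇒∣m+n (ℤ∣.∣m⇒∣m*n _ p∣N₁) (ℤ∣.∣m⇒∣m*n _ p∣N₂) ,
    (λ p∣D₁D₂ → ∤-* p-prime p∤D₁ p∤D₂ (subst (+ p ∣_) (ℤP.pos-* (suc D₁) (suc D₂)) p∣D₁D₂)) ,
    /-+-/ N₁ D₁ N₂ D₂

  pℤ₍ₚ₎-≡ : ∀ {x y} → x ≡ y → pℤ₍ₚ₎ x → pℤ₍ₚ₎ y
  pℤ₍ₚ₎-≡ refl x∈ = x∈

  open +-*-Solver

  ≈-reflexive : ∀ {x y} → x ≡ y → x ≈ y
  ≈-reflexive {x} refl = ≈-intro (pℤ₍ₚ₎-≡ (sym (ℚP.+-inverseʳ x)) pℤ₍ₚ₎-0)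

  ≈-trans : ∀ {x y z} → x ≈ y → y ≈ z → x ≈ z
  ≈-trans {x} {y} {z} (≈-intro x-y) (≈-intro y-z) = ≈-intro (pℤ₍ₚ₎-≡ (sym (telescope x y z)) (pℤ₍ₚ₎-+ x-y y-z))
    where
    telescope : ∀ x y z → x ℚ.- z ≡ (x ℚ.- y) ℚ.+ (y ℚ.- z)
    telescope = solve 3 (λ x y z → x :- z := (x :- y) :+ (y :- z)) refl

  ≈-+ : ∀ {x y u v} → x ≈ u → y ≈ v → x ℚ.+ y ≈ u ℚ.+ v
  ≈-+ {x} {y} {u} {v} (≈-intro x-u) (≈-intro y-v) = ≈-intro (pℤ₍ₚ₎-≡ (sym (interchange x y u v)) (pℤ₍ₚ₎-+ x-u y-v))
    where
    interchange : ∀ x y u v → (x ℚ.+ y) ℚ.- (u ℚ.+ v) ≡ (x ℚ.- u) ℚ.+ (y ℚ.- v)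
    interchange = solve 4 (λ x y u v → (x :+ y) :- (u :+ v) := (x :- u) :+ (y :- v)) refl

  -- The numerator of x ∈ p ℤ₍ₚ₎ in lowest terms is still divisible by p, since reducing
  -- N / (1 + D) only divides out factors of 1 + D, which is prime to p.
  ≈⇒≡[modℚ] : ∀ {x y} → x ≈ y → x ≡ y [modℚ p ]
  ≈⇒≡[modℚ] {x} {y} (≈-intro (N , D , p∣N , p∤D , eq)) = p∣↥ , p∤↧
    where
    z = x ℚ.- y
    cross : ↥ z * + suc D ≡ N * ↧ z
    cross = ↥*≡*↧ z N D eq
    p∣↥ : + p ∣ ↥ z
    p∣↥ = ∣-*-cancelʳ p-prime p∤D (subst (+ p ∣_) (sym cross) (ℤ∣.∣m⇒∣m*n (↧ z) p∣N))
    ↧∣↥*D : ↧ₙ z ℕ∣.∣ ℤ.∣ ↥ z ∣ ℕ.* suc D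
    ↧∣↥*D = subst (ℕ∣._∣_ (↧ₙ z)) (trans (cong ℤ.∣_∣ (sym cross)) (ℤP.abs-* (↥ z) (+ suc D)))
      (subst (ℕ∣._∣_ (↧ₙ z)) (sym (ℤP.abs-* N (↧ z))) (ℕ∣.∣n⇒∣m*n ℤ.∣ N ∣ ℕ∣.∣-refl))
    ↧-coprime-↥ : ∀ q → Coprimality.Coprime (↧ₙ q) ℤ.∣ ↥ q ∣
    ↧-coprime-↥ (ℚ.mkℚ _ _ c) = Coprimality.sym (Coprimality.recompute c)
    p∤↧ : ¬ (p ℕ∣.∣ ↧ₙ z)
    p∤↧ p∣↧ = p∤D (ℤ∣.∣ᵤ⇒∣ (ℕ∣.∣-trans p∣↧ (Coprimality.coprime-divisor (↧-coprime-↥ z) ↧∣↥*D)))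

  -- C(p, m+1)/p ≡ (-1)ᵐ/(m+1), because (m+1) C(p, m+1) = p C(p-1, m) and C(p-1, m) ≡ (-1)ᵐ.
  /[1+m]≈pC[1+m]/p : ∀ a m → suc m ℕ.< p → a / suc m ≈ (-1ℤ ^ m * a * + (p C suc m)) / p
  /[1+m]≈pC[1+m]/p a m 1+m<p with [p-1]Ck≡[-1]^k p-prime m (ℕP.<⇒≤ (ℕP.≤-pred 1+m<p))
  ... | divides s b′-u≡sp = ≈-intro (N , m , p∣N , ∤-small 1+m<p , difference)
    where
    u = -1ℤ ^ m
    b = + (p C suc m)
    b′ = + (P C m)
    N = - (u * a * s * + p)
    p∣N : + p ∣ N
    p∣N = ℤ∣.∣m⇒∣-m (ℤ∣.∣n⇒∣m*n (u * a * s) ℤ∣.∣-refl)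
    absorption : b * + suc m ≡ + p * b′
    absorption = trans (sym (ℤP.pos-* (p C suc m) (suc m))) (trans
      (cong +_ (trans (ℕP.*-comm (p C suc m) (suc m)) ([1+k]*[1+n]C[1+k]≡[1+n]*nCk P m)))
      (ℤP.pos-* p (P C m)))
    b′≡u+sp : b′ ≡ u + s * + p
    b′≡u+sp = trans (recentre b′ u) (trans (cong (_+ u) b′-u≡sp) (ℤP.+-comm (s * + p) u))
      where
      recentre : ∀ b u → b ≡ b - u + u
      recentre = solve-∀
    cross : (a * + p + - (u * a * b) * + suc m) * + suc m ≡ N * + (suc m ℕ.* p)
    cross = trans (binomial-cross a (+ p) u s b b′ (+ suc m) absorption b′≡u+sp ([-1]^n*[-1]^n≡1 m))
      (trans (ℤP.neg-distribˡ-* (u * a * s * + p) (+ suc m * + p)) (cong (N *_) (sym (ℤP.pos-* (suc m) p))))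
    difference : a / suc m ℚ.- (u * a * b) / p ≡ N / suc m
    difference = begin
      a / suc m ℚ.+ ℚ.- ((u * a * b) / p)                  ≡⟨ cong (a / suc m ℚ.+_) (-‿/ (u * a * b) P) ⟩
      a / suc m ℚ.+ (- (u * a * b)) / p                    ≡⟨ /-+-/ a m (- (u * a * b)) P ⟩
      (a * + p + - (u * a * b) * + suc m) / (suc m ℕ.* p)
        ≡⟨ /-cross (a * + p + - (u * a * b) * + suc m) (P ℕ.+ m ℕ.* p) N m cross ⟩
      N / suc m ∎
      where open ≡-Reasoning

  ≈-≡ : ∀ {x y z} → x ≈ y → y ≡ z → x ≈ z
  ≈-≡ x≈y refl = x≈y

  /p≈/p : ∀ A B → + p * + p ∣ A - B → A / p ≈ B / p
  /p≈/p A B (divides k A-B≡) = ≈-intro (k * + p , 0 , ℤ∣.∣n⇒∣m*n k ℤ∣.∣-refl , ∤-small 1<p ,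
    trans (-/-same A B P) (/-cross (A - B) P (k * + p) 0 cancel-p))
    where
    reassoc : ∀ k p → k * (p * p) * + 1 ≡ k * p * p
    reassoc = solve-∀
    cancel-p : (A - B) * + 1 ≡ k * + p * + p
    cancel-p = trans (cong (_* + 1) A-B≡) (reassoc k (+ p))

  ≈-sumFrom1 : ∀ n f g → (∀ j → j ℕ.< n → f (suc j) ≈ g j / p) → sumFrom1 n f ≈ ∑ n g / p
  ≈-sumFrom1 zero    f g _     = ≈-reflexive (sym (ℚP.0/n≡0 p))
  ≈-sumFrom1 (suc n) f g terms = ≈-≡
    (≈-+ (≈-sumFrom1 n f g (λ j j<n → terms j (ℕP.m<n⇒m<1+n j<n))) (terms n ℕP.≤-refl))
    (trans (/-+-/-same (∑ n g) (g n) P) (cong (_/ p) (sym (∑-last n g))))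

[-1]^n*[-2]^n≡2^n : ∀ n → -1ℤ ^ n * -[1+ 1 ] ^ n ≡ (+ 2) ^ n
[-1]^n*[-2]^n≡2^n n = sym (^-distribʳ-* -1ℤ -[1+ 1 ] n)

[-8]^j≡[-2]^3j : ∀ j → -[1+ 7 ] ^ j ≡ -[1+ 1 ] ^ (3 ℕ.* j)
[-8]^j≡[-2]^3j j = ℤP.^-*-assoc -[1+ 1 ] 3 j

difference≡L[t-L]² : ∀ L t x → L * L ≡ + 1 →
  - (+ 2 * t - L * (+ 2 * x)) - L * (+ 2 * (x - + 1) - (t * t - + 1)) ≡ L * (t - L) * (t - L)
difference≡L[t-L]² L t x L*L≡1 = trans (expand L t x)
  (trans (cong (λ q → L * (t - L) * (t - L) + (q - + 1) * (+ 2 * t - L)) L*L≡1) (drop L t))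
  where
  expand : ∀ L t x → - (+ 2 * t - L * (+ 2 * x)) - L * (+ 2 * (x - + 1) - (t * t - + 1))
                       ≡ L * (t - L) * (t - L) + (L * L - + 1) * (+ 2 * t - L)
  expand = solve-∀
  drop : ∀ L t → L * (t - L) * (t - L) + (+ 1 - + 1) * (+ 2 * t - L) ≡ L * (t - L) * (t - L)
  drop = solve-∀

module AtOddPrime {h : ℕ} (p-prime : Prime (suc (h ℕ.+ h))) (3<p : 3 ℕ.< suc (h ℕ.+ h)) where

  open PIntegral p-prime

  P p : ℕ
  P = h ℕ.+ h
  p = suc P

  G G₁ G₂ : ℕ → ℤ
  G m  = (+ 2) ^ m * + (p C m)
  G₁ j = G (1 ℕ.+ 3 ℕ.* j)
  G₂ j = G (2 ℕ.+ 3 ℕ.* j)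

  K₁ K₂ : ℕ
  K₁ = (p ℕ.+ 1) ℕ./ 3
  K₂ = p ℕ./ 3

  -- The j-th terms of the two sums are (-2)ᵐ/m for m = 3j + 1 and -(-2)ᵐ/m for m = 3j + 2.
  term₁ : ∀ j → j ℕ.< K₁ → (-[1+ 7 ] ^ suc j) / (4 ℕ.+ 12 ℕ.* j) ≈ (- G₁ j) / p
  term₁ j j<K = ≈-trans (≈-reflexive exact) (≈-≡ (/[1+m]≈pC[1+m]/p a m 1+m<p) (cong (_/ p) numerator))
    where
    m = 3 ℕ.* j
    s = -[1+ 1 ] ^ m
    a = -[1+ 1 ] * s
    1+m<p : suc m ℕ.< p
    1+m<p = ℕP.≤-pred (subst (3 ℕ.+ m ℕ.≤_) (ℕP.+-comm p 1) (j<M/3⇒3+3j≤M j<K))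
    denominator : + (4 ℕ.+ 12 ℕ.* j) ≡ + 4 * + suc m
    denominator = trans (cong +_ (factor j)) (ℤP.pos-* 4 (suc m))
      where
      factor : ∀ j → 4 ℕ.+ 12 ℕ.* j ≡ 4 ℕ.* suc (3 ℕ.* j)
      factor = ℕ-solve-∀
    cross : -[1+ 7 ] ^ suc j * + suc m ≡ a * + (4 ℕ.+ 12 ℕ.* j)
    cross = trans (cong (λ t → -[1+ 7 ] * t * + suc m) ([-8]^j≡[-2]^3j j))
      (trans (cancel-4 s (+ suc m)) (cong (a *_) (sym denominator)))
      where
      cancel-4 : ∀ s M → -[1+ 7 ] * s * M ≡ -[1+ 1 ] * s * (+ 4 * M)
      cancel-4 = solve-∀
    exact : (-[1+ 7 ] ^ suc j) / (4 ℕ.+ 12 ℕ.* j) ≡ a / suc m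
    exact = /-cross (-[1+ 7 ] ^ suc j) (3 ℕ.+ 12 ℕ.* j) a m cross
    numerator : -1ℤ ^ m * a * + (p C suc m) ≡ - G (suc m)
    numerator = trans (regroup (-1ℤ ^ m) s (+ (p C suc m)))
      (cong (λ t → - (+ 2 * t * + (p C suc m))) ([-1]^n*[-2]^n≡2^n m))
      where
      regroup : ∀ u s c → u * (-[1+ 1 ] * s) * c ≡ - (+ 2 * (u * s) * c)
      regroup = solve-∀

  term₂ : ∀ j → j ℕ.< K₂ → (-[1+ 7 ] ^ suc j) / (4 ℕ.+ 6 ℕ.* j) ≈ G₂ j / p
  term₂ j j<K = ≈-trans (≈-reflexive exact) (≈-≡ (/[1+m]≈pC[1+m]/p a m 1+m<p) (cong (_/ p) numerator))
    where
    m = 1 ℕ.+ 3 ℕ.* j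
    s = -[1+ 1 ] ^ (3 ℕ.* j)
    a = -[1+ 3 ] * s
    1+m<p : suc m ℕ.< p
    1+m<p = j<M/3⇒3+3j≤M j<K
    denominator : + (4 ℕ.+ 6 ℕ.* j) ≡ + 2 * + suc m
    denominator = trans (cong +_ (factor j)) (ℤP.pos-* 2 (suc m))
      where
      factor : ∀ j → 4 ℕ.+ 6 ℕ.* j ≡ 2 ℕ.* suc (1 ℕ.+ 3 ℕ.* j)
      factor = ℕ-solve-∀
    cross : -[1+ 7 ] ^ suc j * + suc m ≡ a * + (4 ℕ.+ 6 ℕ.* j)
    cross = trans (cong (λ t → -[1+ 7 ] * t * + suc m) ([-8]^j≡[-2]^3j j))
      (trans (cancel-2 s (+ suc m)) (cong (a *_) (sym denominator)))
      where
      cancel-2 : ∀ s M → -[1+ 7 ] * s * M ≡ -[1+ 3 ] * s * (+ 2 * M)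
      cancel-2 = solve-∀
    exact : (-[1+ 7 ] ^ suc j) / (4 ℕ.+ 6 ℕ.* j) ≡ a / suc m
    exact = /-cross (-[1+ 7 ] ^ suc j) (3 ℕ.+ 6 ℕ.* j) a m cross
    numerator : -1ℤ ^ m * a * + (p C suc m) ≡ G (suc m)
    numerator = trans (regroup (-1ℤ ^ (3 ℕ.* j)) s (+ (p C suc m)))
      (cong (λ t → + 2 * (+ 2 * t) * + (p C suc m)) ([-1]^n*[-2]^n≡2^n (3 ℕ.* j)))
      where
      regroup : ∀ u s c → -1ℤ * u * (-[1+ 3 ] * s) * c ≡ + 2 * (+ 2 * (u * s)) * c
      regroup = solve-∀

  characterSum-split : characterSum p ≡ ∑ K₁ G₁ - ∑ K₂ G₂
  characterSum-split = begin
    characterSum p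
      ≡⟨ ∑-cong P (λ m _ → ℤP.*-assoc (χ₃ (suc m)) ((+ 2) ^ suc m) (+ (p C suc m))) ⟩
    ∑ P (λ m → χ₃ (suc m) * G (suc m))
      ≡⟨ χ₃-split G P ⟩
    ∑ ((P ℕ.+ 2) ℕ./ 3) G₁ - ∑ ((P ℕ.+ 1) ℕ./ 3) G₂
      ≡⟨ cong₂ (λ k₁ k₂ → ∑ (k₁ ℕ./ 3) G₁ - ∑ (k₂ ℕ./ 3) G₂) (ℕP.+-suc P 1) (ℕP.+-comm P 1) ⟩
    ∑ K₁ G₁ - ∑ K₂ G₂ ∎
    where open ≡-Reasoning

  lhs≈-characterSum/p : sumFrom1 K₁ (λ k → (-[1+ 7 ] ^ k) / (4 ℕ.+ 12 ℕ.* (k ℕ.∸ 1)))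
                          ℚ.+ sumFrom1 K₂ (λ k → (-[1+ 7 ] ^ k) / (4 ℕ.+ 6 ℕ.* (k ℕ.∸ 1)))
                        ≈ (- characterSum p) / p
  lhs≈-characterSum/p = ≈-≡
    (≈-+ (≈-sumFrom1 K₁ _ (λ j → - G₁ j) term₁) (≈-sumFrom1 K₂ _ G₂ term₂))
    (trans (/-+-/-same (∑ K₁ (λ j → - G₁ j)) (∑ K₂ G₂) P) (cong (_/ p) (begin
      ∑ K₁ (λ j → - G₁ j) + ∑ K₂ G₂   ≡⟨ cong (_+ ∑ K₂ G₂) (∑-neg K₁ G₁) ⟩
      - ∑ K₁ G₁ + ∑ K₂ G₂             ≡⟨ negate (∑ K₁ G₁) (∑ K₂ G₂) ⟩
      - (∑ K₁ G₁ - ∑ K₂ G₂)           ≡⟨ cong -_ characterSum-split ⟨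
      - characterSum p ∎)))
    where
    open ≡-Reasoning
    negate : ∀ a b → - a + b ≡ - (a - b)
    negate = solve-∀

  L t : ℤ
  L = χ₃ p
  t = -[1+ 2 ] ^ h

  L*L≡1 : L * L ≡ + 1
  L*L≡1 = byResidue (prime-mod3 p-prime 3<p)
    where
    byResidue : ∃ (λ j → p ≡ 1 ℕ.+ 3 ℕ.* j ⊎ p ≡ 2 ℕ.+ 3 ℕ.* j) → L * L ≡ + 1
    byResidue (j , inj₁ p≡) = cong (λ c → c * c) (trans (cong χ₃ p≡) (χ₃-periodic 1 j))
    byResidue (j , inj₂ p≡) = cong (λ c → c * c) (trans (cong χ₃ p≡) (χ₃-periodic 2 j))

  3^P≡t*t : (+ 3) ^ P ≡ t * t
  3^P≡t*t = trans (sym ([a*a]^h≡a^[h+h] (+ 3) h))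
    (trans ([a*a]^h≡a^[h+h] -[1+ 2 ] h) (ℤP.^-distribˡ-+-* -[1+ 2 ] h h))

  rhsNumerator : ℤ
  rhsNumerator = L * (+ 2 * ((+ 2) ^ P - + 1) - ((+ 3) ^ P - + 1))

  rhs≡rhsNumerator/p : (legendre -[1+ 2 ] p / 1) ℚ.* ((+ 2 / 1) ℚ.* fermatQuotient p (+ 2) ℚ.- fermatQuotient p (+ 3))
                       ≡ rhsNumerator / p
  rhs≡rhsNumerator/p = begin
    (legendre -[1+ 2 ] p / 1) ℚ.* ((+ 2 / 1) ℚ.* (Q₂ / p) ℚ.- Q₃ / p)
      ≡⟨ cong₂ (λ l x → (l / 1) ℚ.* (x ℚ.- Q₃ / p)) (legendre[-3] p-prime 3<p) (/1-*-/ (+ 2) Q₂ P) ⟩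
    (L / 1) ℚ.* ((+ 2 * Q₂) / p ℚ.- Q₃ / p)
      ≡⟨ cong ((L / 1) ℚ.*_) (-/-same (+ 2 * Q₂) Q₃ P) ⟩
    (L / 1) ℚ.* ((+ 2 * Q₂ - Q₃) / p)
      ≡⟨ /1-*-/ L (+ 2 * Q₂ - Q₃) P ⟩
    (L * (+ 2 * Q₂ - Q₃)) / p ∎
    where
    open ≡-Reasoning
    Q₂ = (+ 2) ^ P - + 1
    Q₃ = (+ 3) ^ P - + 1

  p²∣-characterSum-rhsNumerator : + p * + p ∣ - characterSum p - rhsNumerator
  p²∣-characterSum-rhsNumerator = square (euler[-3] {h = h} p-prime refl)
    where
    open ≡-Reasoning
    regroup : ∀ L w p → L * (w * p) * (w * p) ≡ L * w * w * (p * p)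
    regroup = solve-∀
    square : + p ∣ t - L → + p * + p ∣ - characterSum p - rhsNumerator
    square (divides w t-L≡wp) = divides (L * w * w) (begin
      - characterSum p - L * (+ 2 * ((+ 2) ^ P - + 1) - ((+ 3) ^ P - + 1))
        ≡⟨ cong₂ (λ v y → - v - L * (+ 2 * ((+ 2) ^ P - + 1) - (y - + 1)))
                 (characterSum[1+2h] h) 3^P≡t*t ⟩
      - (+ 2 * t - L * (+ 2 * (+ 2) ^ P)) - L * (+ 2 * ((+ 2) ^ P - + 1) - (t * t - + 1))
        ≡⟨ difference≡L[t-L]² L t ((+ 2) ^ P) L*L≡1 ⟩
      L * (t - L) * (t - L)
        ≡⟨ cong (λ e → L * e * e) t-L≡wp ⟩
      L * (w * + p) * (w * + p)
        ≡⟨ regroup L w (+ p) ⟩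
      L * w * w * (+ p * + p) ∎)

corollary4p8 : (p : ℕ) → .{{_ : ℕ.NonZero p}} → Prime p → p > 3 →
    (sumFrom1 ((p ℕ.+ 1) ℕ./ 3) (λ k → (-[1+ 7 ] ℤ.^ k) ℚ./ (4 ℕ.+ 12 ℕ.* (k ℕ.∸ 1)))
      ℚ.+ sumFrom1 (p ℕ./ 3) (λ k → (-[1+ 7 ] ℤ.^ k) ℚ./ (4 ℕ.+ 6 ℕ.* (k ℕ.∸ 1))))
    ≡ ((legendre -[1+ 2 ] p) ℚ./ 1) ℚ.* (((+ 2) ℚ./ 1) ℚ.* fermatQuotient p (+ 2) ℚ.- fermatQuotient p (+ 3))
      [modℚ p ]
corollary4p8 p p-prime 3<p with prime-odd p-prime (ℕP.<-trans (ℕP.n<1+n 2) 3<p)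
... | h , refl = ≈⇒≡[modℚ] (≈-≡
  (≈-trans lhs≈-characterSum/p (/p≈/p (- characterSum p) rhsNumerator p²∣-characterSum-rhsNumerator))
  (sym rhs≡rhsNumerator/p))
  where
  open PIntegral p-prime
  open AtOddPrime {h} p-prime 3<p using (lhs≈-characterSum/p; rhsNumerator; p²∣-characterSum-rhsNumerator; rhs≡rhsNumerator/p)
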